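{- Let $\mathcal{F}(q)=\sum_{n\ge0} f_nq^n$ and $\bar{\mathcal{F}}(q)=\sum_{n\ge0}\bar f_nq^n$ be elements of $\mathbb{F}_2[[q]]$ with $\mathcal{F}(q)\bar{\mathcal{F}}(q)=1$, and let $F=\{n\ge0: f_n=1\}$. Then $\bar f_0=1$, and for every $n>0$: (i) $\bar f_n=\sum_{j=1}^{n} f_j\bar f_{n-j}$; (ii) $\bar f_n=1$ if and only if the number of sequences $(x_0,x_1,x_2,\dots)$ with every $x_i\in F$ and $n=\sum_{i\ge0}x_i2^i$ is odd; (iii) $\bar f_n=\sum_{\vec x} f_{x_1}f_{x_2}\cdots f_{x_\ell}$, where the sum (in $\mathbb{F}_2$) extends over all tuples $\vec x=(x_1,\dots,x_\ell)$ of positive integers (of any length $\ell\ge1$) with $x_1+\cdots+x_\ell=n$; (iv) there is a function $G=G_n:\{0,1\}^{\lfloor n/2\rfloor}\to\mathbb{F}_2$, depending only on $n$ and not on $\mathcal{F}$, such that \[ \bar f_n=\sum_{0\le i<n/4} f_{n-2i}\bar f_i+G(f_1,f_2,\dots,f_{\lfloor n/2\rfloor}). \]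
   Context: $\mathbb{F}_2[[q]]$ is the ring of formal power series over the two-element field; coefficients $f_n,\bar f_n\in\{0,1\}$ are treated as elements of $\mathbb{F}_2$ in the sums. Note that $f_0=1$ follows from $\mathcal{F}\bar{\mathcal{F}}=1$. In (ii), since $0\in F$ and $x_i\ge 0$, the relevant sequences are eventually zero. -}

module Defs where

open import Data.Bool using (Bool; true; false; _∧_; _xor_)
open import Data.Nat using (ℕ; zero; suc; _+_; _*_; _∸_; _^_; _≡ᵇ_; _<ᵇ_)
open import Data.Fin using (Fin; toℕ)
open import Data.List using (List; []; _∷_; [_]; map; concatMap; upTo; filterᵇ; length; foldr)
open import Data.Vec using (Vec; lookup; tabulate)
import Data.Vec as Vec
open import Relation.Binary.PropositionalEquality using (_≡_)

-- An element of F₂[[q]] is its coefficient sequence; Bool ≅ F₂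
-- (xor = addition, ∧ = multiplication).
Series : Set
Series = ℕ → Bool

⊕< : ℕ → (ℕ → Bool) → Bool
⊕< zero    g = false
⊕< (suc n) g = ⊕< n g xor g n

⊕L : List Bool → Bool
⊕L = foldr _xor_ false

mulCoeff : Series → Series → ℕ → Bool
mulCoeff f g n = ⊕< (suc n) (λ k → f k ∧ g (n ∸ k))

oneS : Series
oneS zero    = true
oneS (suc _) = false

IsInverse : Series → Series → Set
IsInverse f g = ∀ n → mulCoeff f g n ≡ oneS n

allVecs : ℕ → (L : ℕ) → List (Vec ℕ L)
allVecs b zero    = [ Vec.[] ]
allVecs b (suc L) = concatMap (λ x → map (x Vec.∷_) (allVecs b L)) (upTo (suc b))

weighted : {L : ℕ} → Vec ℕ L → ℕ
weighted {L} v = Vec.sum (tabulate (λ (i : Fin L) → lookup v i * 2 ^ toℕ i))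

allᵇ : {L : ℕ} → (ℕ → Bool) → Vec ℕ L → Bool
allᵇ p v = Vec.foldr _ (λ x b → p x ∧ b) true v

-- Number of sequences (x_0,…,x_{L-1}) with every x_i ∈ F = {m : f m = 1}
-- and n = Σ x_i 2^i.  (Entries bounded by n, which is forced.)
repCount : Series → ℕ → ℕ → ℕ
repCount f n L =
  length (filterᵇ (λ v → allᵇ f v ∧ (weighted v ≡ᵇ n)) (allVecs n L))

-- Σ over all tuples (x_1,…,x_ℓ) of positive integers, ℓ ≥ 1, with
-- x_1+⋯+x_ℓ = n, of f_{x_1}⋯f_{x_ℓ}, in F₂.  (ℓ ≤ n and x_i ≤ n are forced.)
compositionSum : Series → ℕ → Bool
compositionSum f n =
  ⊕< n (λ k → ⊕L (map (allᵇ f)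
     (filterᵇ (λ v → allᵇ (λ x → 0 <ᵇ x) v ∧ (Vec.sum v ≡ᵇ n))
              (allVecs n (suc k)))))

{-# OPTIONS --safe #-}
-- Squaring is additive over F₂, so F̄² = F̄(q²) and therefore F̄ = F·F̄² = F·F̄(q²), that is,
-- f̄ₙ = Σ_{x+2i=n} f_x f̄ᵢ.  Peeling off the binary digits of n one at a time with this identity
-- gives (ii); splitting it at i = n/4 gives (iv), because for i ≥ n/4 both n − 2i and i are at
-- most n/2 and f̄ᵢ only depends on f₁,…,fᵢ.  Parts (i) and (iii) come from the recurrence
-- f̄ₙ = Σ_{j≥1} f_j f̄_{n−j}, which determines f̄ from f.
module Submission where

open import Defs
open import Algebra using (CommutativeRing)
open import Data.Bool using (Bool; true; false; _∧_; _xor_; not; if_then_else_)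
open import Data.Bool.Properties
  using (xor-assoc; xor-comm; xor-identityʳ; ∧-assoc; ∧-comm; ∧-zeroʳ; ∧-idem; ∧-distribˡ-xor;
         not-involutive; xor-∧-commutativeRing; ∧-commutativeMonoid)
open import Data.Nat
  using (ℕ; zero; suc; _+_; _∸_; _*_; _^_; _<_; _≤_; _/_; _%_; _<ᵇ_; _≤ᵇ_; _≡ᵇ_; z≤n; s≤s; z<s; ⌊_/2⌋)
open import Data.Nat.Properties
open import Data.Nat.DivMod using (m/n≡1+[m∸n]/n)
open import Data.Nat.Tactic.RingSolver using (solve-∀)
open import Data.Fin using (Fin; zero; suc; toℕ)
open import Data.List using (List; []; _∷_; map; concatMap; upTo; applyUpTo; filterᵇ; length; _++_)
open import Data.List.Properties using (map-∘)
open import Data.Vec using (Vec; []; _∷_; lookup; tabulate)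
import Data.Vec as Vec
open import Data.Product using (_×_; _,_; proj₁; proj₂; Σ-syntax)
open import Data.Sum using (inj₁; inj₂)
open import Function.Bundles using (_⇔_; mk⇔)
open import Relation.Binary.PropositionalEquality
open import Relation.Nullary using (yes; no)
open import Relation.Nullary.Reflects using (ofʸ; ofⁿ; det)
open import Algebra.Properties.CommutativeSemigroup (CommutativeRing.+-commutativeSemigroup xor-∧-commutativeRing)
  using (interchange)
open import Algebra.Solver.CommutativeMonoid ∧-commutativeMonoid using (solve; _⊜_; _⊕_)

-- Sums over F₂

⊕<-cong : ∀ n {g h : ℕ → Bool} → (∀ i → i < n → g i ≡ h i) → ⊕< n g ≡ ⊕< n h
⊕<-cong zero    eq = refl
⊕<-cong (suc n) eq = cong₂ _xor_ (⊕<-cong n (λ i i<n → eq i (m<n⇒m<1+n i<n))) (eq n ≤-refl)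

⊕<-false : ∀ n {g : ℕ → Bool} → (∀ i → i < n → g i ≡ false) → ⊕< n g ≡ false
⊕<-false zero    eq = refl
⊕<-false (suc n) eq = cong₂ _xor_ (⊕<-false n (λ i i<n → eq i (m<n⇒m<1+n i<n))) (eq n ≤-refl)

⊕<-xor : ∀ n (g h : ℕ → Bool) → ⊕< n (λ i → g i xor h i) ≡ ⊕< n g xor ⊕< n h
⊕<-xor zero    g h = refl
⊕<-xor (suc n) g h =
  trans (cong (_xor (g n xor h n)) (⊕<-xor n g h)) (interchange (⊕< n g) (⊕< n h) (g n) (h n))

⊕<-∧ˡ : ∀ n b (g : ℕ → Bool) → b ∧ ⊕< n g ≡ ⊕< n (λ i → b ∧ g i)
⊕<-∧ˡ n true  g = refl
⊕<-∧ˡ n false g = sym (⊕<-false n (λ _ _ → refl))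

⊕<-split : ∀ n (c g : ℕ → Bool) →
           ⊕< n g ≡ ⊕< n (λ i → c i ∧ g i) xor ⊕< n (λ i → not (c i) ∧ g i)
⊕<-split n c g = trans (⊕<-cong n (λ i _ → by-cases (c i) (g i))) (⊕<-xor n _ _)
  where
  by-cases : ∀ c x → x ≡ (c ∧ x) xor (not c ∧ x)
  by-cases true  x = sym (xor-identityʳ x)
  by-cases false x = refl

⊕<-sucˡ : ∀ n (g : ℕ → Bool) → ⊕< (suc n) g ≡ g 0 xor ⊕< n (λ i → g (suc i))
⊕<-sucˡ zero    g = xor-comm false (g 0)
⊕<-sucˡ (suc n) g = trans (cong (_xor g (suc n)) (⊕<-sucˡ n g)) (xor-assoc (g 0) _ _)

⊕<-reverse : ∀ n (g : ℕ → Bool) → ⊕< n g ≡ ⊕< n (λ i → g (n ∸ suc i))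
⊕<-reverse zero    g = refl
⊕<-reverse (suc n) g = begin
  ⊕< n g xor g n                        ≡⟨ xor-comm _ (g n) ⟩
  g n xor ⊕< n g                        ≡⟨ cong (g n xor_) (⊕<-reverse n g) ⟩
  g n xor ⊕< n (λ i → g (n ∸ suc i))   ≡⟨ ⊕<-sucˡ n (λ i → g (n ∸ i)) ⟨
  ⊕< (suc n) (λ i → g (n ∸ i))         ∎
  where open ≡-Reasoning

⊕<-swap : ∀ m n (a : ℕ → ℕ → Bool) →
          ⊕< m (λ i → ⊕< n (a i)) ≡ ⊕< n (λ j → ⊕< m (λ i → a i j))
⊕<-swap zero    n a = sym (⊕<-false n (λ _ _ → refl))
⊕<-swap (suc m) n a = trans (cong (_xor ⊕< n (a m)) (⊕<-swap m n a))
                            (sym (⊕<-xor n (λ j → ⊕< m (λ i → a i j)) (a m)))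

⊕<-extend : ∀ {m n} (g : ℕ → Bool) → (∀ i → m ≤ i → g i ≡ false) → m ≤ n →
            ⊕< m g ≡ ⊕< n g
⊕<-extend {n = zero}  g vanish z≤n = refl
⊕<-extend {m} {suc n} g vanish m≤1+n with m≤n⇒m<n∨m≡n m≤1+n
... | inj₂ refl      = refl
... | inj₁ (s≤s m≤n) = begin
  ⊕< m g                ≡⟨ ⊕<-extend g vanish m≤n ⟩
  ⊕< n g                ≡⟨ xor-identityʳ _ ⟨
  ⊕< n g xor false      ≡⟨ cong (⊕< n g xor_) (vanish n m≤n) ⟨
  ⊕< n g xor g n        ∎
  where open ≡-Reasoning

⊕<-diagonal : ∀ n (a : ℕ → ℕ → Bool) → (∀ i j → a i j ≡ a j i) →
              ⊕< n (λ i → ⊕< n (a i)) ≡ ⊕< n (λ i → a i i)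
⊕<-diagonal zero    a a-sym = refl
⊕<-diagonal (suc n) a a-sym = begin
  ⊕< n (λ i → ⊕< n (a i) xor a i n) xor (⊕< n (a n) xor a n n)
    ≡⟨ cong (_xor (⊕< n (a n) xor a n n)) (⊕<-xor n (λ i → ⊕< n (a i)) (λ i → a i n)) ⟩
  (⊕< n (λ i → ⊕< n (a i)) xor ⊕< n (λ i → a i n)) xor (⊕< n (a n) xor a n n)
    ≡⟨ cong (λ t → (⊕< n (λ i → ⊕< n (a i)) xor t) xor (⊕< n (a n) xor a n n))
            (⊕<-cong n (λ i _ → a-sym i n)) ⟩
  (⊕< n (λ i → ⊕< n (a i)) xor ⊕< n (a n)) xor (⊕< n (a n) xor a n n)
    ≡⟨ xor-cancel-middle (⊕< n (λ i → ⊕< n (a i))) (⊕< n (a n)) (a n n) ⟩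
  ⊕< n (λ i → ⊕< n (a i)) xor a n n
    ≡⟨ cong (_xor a n n) (⊕<-diagonal n a a-sym) ⟩
  ⊕< n (λ i → a i i) xor a n n
    ∎
  where
  open ≡-Reasoning
  xor-cancel-middle : ∀ x y z → (x xor y) xor (y xor z) ≡ x xor z
  xor-cancel-middle x     false z = cong (_xor z) (xor-identityʳ x)
  xor-cancel-middle false true  z = not-involutive z
  xor-cancel-middle true  true  z = refl

module _ {A : Set} where

  ⊕L-cong : ∀ {g h : A → Bool} xs → (∀ x → g x ≡ h x) → ⊕L (map g xs) ≡ ⊕L (map h xs)
  ⊕L-cong []       eq = refl
  ⊕L-cong (x ∷ xs) eq = cong₂ _xor_ (eq x) (⊕L-cong xs eq)

  ⊕L-false : ∀ {g : A → Bool} xs → (∀ x → g x ≡ false) → ⊕L (map g xs) ≡ false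
  ⊕L-false []       eq = refl
  ⊕L-false (x ∷ xs) eq = cong₂ _xor_ (eq x) (⊕L-false xs eq)

  ⊕L-∧ˡ : ∀ b (g : A → Bool) xs → ⊕L (map (λ x → b ∧ g x) xs) ≡ b ∧ ⊕L (map g xs)
  ⊕L-∧ˡ b g []       = sym (∧-zeroʳ b)
  ⊕L-∧ˡ b g (x ∷ xs) = trans (cong ((b ∧ g x) xor_) (⊕L-∧ˡ b g xs)) (sym (∧-distribˡ-xor b (g x) _))

  ⊕L-++ : ∀ (g : A → Bool) xs ys → ⊕L (map g (xs ++ ys)) ≡ ⊕L (map g xs) xor ⊕L (map g ys)
  ⊕L-++ g []       ys = refl
  ⊕L-++ g (x ∷ xs) ys = trans (cong (g x xor_) (⊕L-++ g xs ys)) (sym (xor-assoc (g x) _ _))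

  ⊕L-filterᵇ : ∀ (p g : A → Bool) xs → ⊕L (map g (filterᵇ p xs)) ≡ ⊕L (map (λ x → p x ∧ g x) xs)
  ⊕L-filterᵇ p g []       = refl
  ⊕L-filterᵇ p g (x ∷ xs) with p x
  ... | true  = cong (g x xor_) (⊕L-filterᵇ p g xs)
  ... | false = ⊕L-filterᵇ p g xs

⊕L-concatMap : ∀ {A B : Set} (g : B → Bool) (h : A → List B) xs →
               ⊕L (map g (concatMap h xs)) ≡ ⊕L (map (λ x → ⊕L (map g (h x))) xs)
⊕L-concatMap g h []       = refl
⊕L-concatMap g h (x ∷ xs) =
  trans (⊕L-++ g (h x) (concatMap h xs)) (cong (⊕L (map g (h x)) xor_) (⊕L-concatMap g h xs))

⊕L-applyUpTo : ∀ (g : ℕ → Bool) (h : ℕ → ℕ) n → ⊕L (map g (applyUpTo h n)) ≡ ⊕< n (λ i → g (h i))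
⊕L-applyUpTo g h zero    = refl
⊕L-applyUpTo g h (suc n) =
  trans (cong (g (h 0) xor_) (⊕L-applyUpTo g (λ i → h (suc i)) n)) (sym (⊕<-sucˡ n (λ i → g (h i))))

⊕L-allVecs-suc : ∀ B L (p : Vec ℕ (suc L) → Bool) →
  ⊕L (map p (allVecs B (suc L))) ≡ ⊕< (suc B) (λ x → ⊕L (map (λ v → p (x ∷ v)) (allVecs B L)))
⊕L-allVecs-suc B L p = begin
  ⊕L (map p (concatMap (λ x → map (x ∷_) (allVecs B L)) (upTo (suc B))))
    ≡⟨ ⊕L-concatMap p (λ x → map (x ∷_) (allVecs B L)) (upTo (suc B)) ⟩
  ⊕L (map (λ x → ⊕L (map p (map (x ∷_) (allVecs B L)))) (upTo (suc B)))
    ≡⟨ ⊕L-cong (upTo (suc B)) (λ x → cong ⊕L (sym (map-∘ (allVecs B L)))) ⟩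
  ⊕L (map (λ x → ⊕L (map (λ v → p (x ∷ v)) (allVecs B L))) (upTo (suc B)))
    ≡⟨ ⊕L-applyUpTo _ (λ i → i) (suc B) ⟩
  ⊕< (suc B) (λ x → ⊕L (map (λ v → p (x ∷ v)) (allVecs B L)))
    ∎
  where open ≡-Reasoning

isOdd : ℕ → Bool
isOdd zero    = false
isOdd (suc n) = not (isOdd n)

isOdd-length-filterᵇ : ∀ {A : Set} (p : A → Bool) xs → isOdd (length (filterᵇ p xs)) ≡ ⊕L (map p xs)
isOdd-length-filterᵇ p []       = refl
isOdd-length-filterᵇ p (x ∷ xs) with p x
... | true  = cong not (isOdd-length-filterᵇ p xs)
... | false = isOdd-length-filterᵇ p xs

%2≡if-isOdd : ∀ n → n % 2 ≡ (if isOdd n then 1 else 0)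
%2≡if-isOdd zero          = refl
%2≡if-isOdd (suc zero)    = refl
%2≡if-isOdd (suc (suc n)) rewrite not-involutive (isOdd n) = %2≡if-isOdd n

isOdd⇔%2≡1 : ∀ n → isOdd n ≡ true ⇔ n % 2 ≡ 1
isOdd⇔%2≡1 n rewrite %2≡if-isOdd n with isOdd n
... | true  = mk⇔ (λ _ → refl) (λ _ → refl)
... | false = mk⇔ (λ ()) (λ ())

≤ᵇ-true : ∀ {m n} → m ≤ n → (m ≤ᵇ n) ≡ true
≤ᵇ-true {m} {n} m≤n = det (≤ᵇ-reflects-≤ m n) (ofʸ m≤n)

≤ᵇ-false : ∀ {m n} → n < m → (m ≤ᵇ n) ≡ false
≤ᵇ-false {m} {n} n<m = det (≤ᵇ-reflects-≤ m n) (ofⁿ (<⇒≱ n<m))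

+-≡ᵇ : ∀ x s n → (x + s ≡ᵇ n) ≡ (x ≤ᵇ n) ∧ (s ≡ᵇ n ∸ x)
+-≡ᵇ zero          s n       = refl
+-≡ᵇ (suc x)       s zero    = refl
+-≡ᵇ (suc zero)    s (suc n) = refl
+-≡ᵇ (suc (suc x)) s (suc n) = +-≡ᵇ (suc x) s n

m+m≡ᵇn+n : ∀ m n → (m + m ≡ᵇ n + n) ≡ (m ≡ᵇ n)
m+m≡ᵇn+n zero    zero    = refl
m+m≡ᵇn+n zero    (suc n) = refl
m+m≡ᵇn+n (suc m) zero    = refl
m+m≡ᵇn+n (suc m) (suc n) rewrite +-suc m m | +-suc n n = m+m≡ᵇn+n m n

m+m≡ᵇ1+n+n : ∀ m n → (m + m ≡ᵇ suc (n + n)) ≡ false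
m+m≡ᵇ1+n+n zero    n       = refl
m+m≡ᵇ1+n+n (suc m) zero    rewrite +-suc m m = refl
m+m≡ᵇ1+n+n (suc m) (suc n) rewrite +-suc m m | +-suc n n = m+m≡ᵇ1+n+n m n

m+m<n+n⇒m<n : ∀ {m n} → m + m < n + n → m < n
m+m<n+n⇒m<n m+m<n+n = ≰⇒> (λ n≤m → <⇒≱ m+m<n+n (+-mono-≤ n≤m n≤m))

[m+m]∸[n+n]≡[m∸n]+[m∸n] : ∀ m n → (m + m) ∸ (n + n) ≡ (m ∸ n) + (m ∸ n)
[m+m]∸[n+n]≡[m∸n]+[m∸n] m       zero    = refl
[m+m]∸[n+n]≡[m∸n]+[m∸n] zero    (suc n) = refl
[m+m]∸[n+n]≡[m∸n]+[m∸n] (suc m) (suc n) rewrite +-suc m m | +-suc n n = [m+m]∸[n+n]≡[m∸n]+[m∸n] m n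

m≤⌊n/2⌋⇒m+m≤n : ∀ {m} n → m ≤ ⌊ n /2⌋ → m + m ≤ n
m≤⌊n/2⌋⇒m+m≤n n m≤⌊n/2⌋ =
  ≤-trans (+-mono-≤ m≤⌊n/2⌋ (≤-trans m≤⌊n/2⌋ (⌊n/2⌋≤⌈n/2⌉ n)))
          (≤-reflexive (⌊n/2⌋+⌈n/2⌉≡n n))

m+m≤n⇒m≤⌊n/2⌋ : ∀ m {n} → m + m ≤ n → m ≤ ⌊ n /2⌋
m+m≤n⇒m≤⌊n/2⌋ m m+m≤n = ≤-trans (≤-reflexive (n≡⌊n+n/2⌋ m)) (⌊n/2⌋-mono m+m≤n)

⌊n/2⌋<m⇒n<m+m : ∀ n {m} → ⌊ n /2⌋ < m → n < m + m
⌊n/2⌋<m⇒n<m+m n {m} ⌊n/2⌋<m = ≰⇒> (λ m+m≤n → <⇒≱ ⌊n/2⌋<m (m+m≤n⇒m≤⌊n/2⌋ m m+m≤n))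

⌊1+n+n/2⌋≡n : ∀ n → ⌊ suc (n + n) /2⌋ ≡ n
⌊1+n+n/2⌋≡n zero    = refl
⌊1+n+n/2⌋≡n (suc n) rewrite +-suc n n = cong suc (⌊1+n+n/2⌋≡n n)

⌊n/2⌋≡n/2 : ∀ n → ⌊ n /2⌋ ≡ n / 2
⌊n/2⌋≡n/2 zero          = refl
⌊n/2⌋≡n/2 (suc zero)    = refl
⌊n/2⌋≡n/2 (suc (suc n)) =
  trans (cong suc (⌊n/2⌋≡n/2 n)) (sym (m/n≡1+[m∸n]/n {suc (suc n)} {2} (s≤s (s≤s z≤n))))

4*m≡[m+m]+[m+m] : ∀ m → 4 * m ≡ (m + m) + (m + m)
4*m≡[m+m]+[m+m] = solve-∀

n∸[m+m]≤⌊n/2⌋ : ∀ n m → n ≤ 4 * m → n ∸ (m + m) ≤ ⌊ n /2⌋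
n∸[m+m]≤⌊n/2⌋ n m n≤4m with m + m ≤? n
... | no  m+m≰n = subst (_≤ ⌊ n /2⌋) (sym (m≤n⇒m∸n≡0 (<⇒≤ (≰⇒> m+m≰n)))) z≤n
... | yes m+m≤n = m+m≤n⇒m≤⌊n/2⌋ (n ∸ (m + m)) (begin
  (n ∸ (m + m)) + (n ∸ (m + m))   ≤⟨ +-monoʳ-≤ (n ∸ (m + m)) n∸[m+m]≤m+m ⟩
  (n ∸ (m + m)) + (m + m)         ≡⟨ m∸n+n≡m m+m≤n ⟩
  n                               ∎)
  where
  open ≤-Reasoning
  n∸[m+m]≤m+m : n ∸ (m + m) ≤ m + m
  n∸[m+m]≤m+m = m≤n+o⇒m∸n≤o n (m + m) (subst (n ≤_) (4*m≡[m+m]+[m+m] m) n≤4m)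

data EvenOdd : ℕ → Set where
  even : ∀ h → EvenOdd (h + h)
  odd  : ∀ h → EvenOdd (suc (h + h))

evenOdd : ∀ n → EvenOdd n
evenOdd zero = even 0
evenOdd (suc n) with evenOdd n
... | even h = odd h
... | odd h  = subst (λ m → EvenOdd (suc m)) (+-suc h h) (even (suc h))

-- Inverses of power series

record InverseRecurrence (f g : Series) : Set where
  field
    constant   : g 0 ≡ true
    recurrence : ∀ m → g (suc m) ≡ ⊕< (suc m) (λ k → f (suc k) ∧ g (m ∸ k))

module _ {f g : Series} (inv : IsInverse f g) where

  IsInverse⇒constants : f 0 ≡ true × g 0 ≡ true
  IsInverse⇒constants with f 0 | g 0 | inv 0
  ... | true | true | _ = refl , refl

  IsInverse⇒InverseRecurrence : InverseRecurrence f g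
  IsInverse⇒InverseRecurrence = record { constant = proj₂ IsInverse⇒constants ; recurrence = step }
    where
    open ≡-Reasoning
    xor≡false⇒≡ : ∀ {x y} → x xor y ≡ false → x ≡ y
    xor≡false⇒≡ {false}         eq = sym eq
    xor≡false⇒≡ {true}  {false} ()
    xor≡false⇒≡ {true}  {true}  _  = refl
    step : ∀ m → g (suc m) ≡ ⊕< (suc m) (λ k → f (suc k) ∧ g (m ∸ k))
    step m = xor≡false⇒≡ (begin
      g (suc m) xor ⊕< (suc m) (λ k → f (suc k) ∧ g (m ∸ k))
        ≡⟨ cong (λ c → (c ∧ g (suc m)) xor ⊕< (suc m) (λ k → f (suc k) ∧ g (m ∸ k)))
                (proj₁ IsInverse⇒constants) ⟨
      (f 0 ∧ g (suc m)) xor ⊕< (suc m) (λ k → f (suc k) ∧ g (m ∸ k))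
        ≡⟨ ⊕<-sucˡ (suc m) (λ k → f k ∧ g (suc m ∸ k)) ⟨
      mulCoeff f g (suc m)
        ≡⟨ inv (suc m) ⟩
      false
        ∎)

-- history f m k holds coefficient m ∸ k: the coefficients found so far, newest first, the order
-- in which the recurrence consumes them.  inverse f is an inverse of f only when f 0 ≡ true.
history : Series → ℕ → ℕ → Bool
history f zero    _       = true
history f (suc m) zero    = ⊕< (suc m) (λ k → f (suc k) ∧ history f m k)
history f (suc m) (suc k) = history f m k

inverse : Series → Series
inverse f m = history f m 0

InverseRecurrence⇒history : ∀ {f g} → InverseRecurrence f g → ∀ m k → g (m ∸ k) ≡ history f m k
InverseRecurrence⇒history rec zero    zero    = InverseRecurrence.constant rec
InverseRecurrence⇒history rec zero    (suc k) = InverseRecurrence.constant rec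
InverseRecurrence⇒history {f} rec (suc m) zero =
  trans (InverseRecurrence.recurrence rec m)
        (⊕<-cong (suc m) (λ k _ → cong (f (suc k) ∧_) (InverseRecurrence⇒history rec m k)))
InverseRecurrence⇒history rec (suc m) (suc k) = InverseRecurrence⇒history rec m k

InverseRecurrence⇒≗inverse : ∀ {f g} → InverseRecurrence f g → g ≗ inverse f
InverseRecurrence⇒≗inverse rec n = InverseRecurrence⇒history rec n 0

IsInverse⇒≗inverse : ∀ {f g} → IsInverse f g → g ≗ inverse f
IsInverse⇒≗inverse {f} {g} inv = InverseRecurrence⇒≗inverse (IsInverse⇒InverseRecurrence {f} {g} inv)

IsInverse-unique : ∀ {f g h} → IsInverse f g → IsInverse f h → g ≗ h
IsInverse-unique {f} {g} {h} inv-g inv-h n =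
  trans (IsInverse⇒≗inverse {f} {g} inv-g n) (sym (IsInverse⇒≗inverse {f} {h} inv-h n))

history-local : ∀ {f f′} m → (∀ k → k < m → f (suc k) ≡ f′ (suc k)) →
                ∀ k → history f m k ≡ history f′ m k
history-local zero    agree k       = refl
history-local (suc m) agree zero    = ⊕<-cong (suc m) (λ k k<1+m →
  cong₂ _∧_ (agree k k<1+m) (history-local m (λ j j<m → agree j (m<n⇒m<1+n j<m)) k))
history-local (suc m) agree (suc k) = history-local m (λ j j<m → agree j (m<n⇒m<1+n j<m)) k

inverse-local : ∀ {f f′} m → (∀ k → k < m → f (suc k) ≡ f′ (suc k)) → inverse f m ≡ inverse f′ m
inverse-local m agree = history-local m agree 0

-- dilate g is g(q²).
dilate : Series → Series
dilate g zero          = g 0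
dilate g (suc zero)    = false
dilate g (suc (suc n)) = dilate (λ i → g (suc i)) n

dilate-double : ∀ g h → dilate g (h + h) ≡ g h
dilate-double g zero    = refl
dilate-double g (suc h) rewrite +-suc h h = dilate-double (λ i → g (suc i)) h

dilate-odd : ∀ g h → dilate g (suc (h + h)) ≡ false
dilate-odd g zero    = refl
dilate-odd g (suc h) rewrite +-suc h h = dilate-odd (λ i → g (suc i)) h

dilate-cong : ∀ {g g′} n → (∀ h → h + h ≤ n → g h ≡ g′ h) → dilate g n ≡ dilate g′ n
dilate-cong {g} {g′} n agree with evenOdd n
... | even h = trans (dilate-double g h) (trans (agree h ≤-refl) (sym (dilate-double g′ h)))
... | odd h  = trans (dilate-odd g h) (sym (dilate-odd g′ h))

dilate-oneS : dilate oneS ≗ oneS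
dilate-oneS n with evenOdd n
... | even zero    = refl
... | even (suc h) = dilate-double oneS (suc h)
... | odd h        = dilate-odd oneS h

dilate-∧ʳ : ∀ g (φ : ℕ → Bool) y → dilate g y ∧ φ y ≡ dilate (λ i → g i ∧ φ (i + i)) y
dilate-∧ʳ g φ y with evenOdd y
... | even h = trans (cong (_∧ φ (h + h)) (dilate-double g h)) (sym (dilate-double _ h))
... | odd h  = trans (cong (_∧ φ (suc (h + h))) (dilate-odd g h)) (sym (dilate-odd _ h))

⊕<-dilate-double : ∀ h ψ → ⊕< (h + h) (dilate ψ) ≡ ⊕< h ψ
⊕<-dilate-double zero    ψ = refl
⊕<-dilate-double (suc h) ψ rewrite +-suc h h =
  trans (cong₂ _xor_ (cong₂ _xor_ (⊕<-dilate-double h ψ) (dilate-double ψ h)) (dilate-odd ψ h))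
        (xor-identityʳ _)

⊕<-dilate : ∀ n ψ → ⊕< (suc n) (dilate ψ) ≡ ⊕< (suc ⌊ n /2⌋) ψ
⊕<-dilate n ψ with evenOdd n
... | even h rewrite sym (n≡⌊n+n/2⌋ h) = cong₂ _xor_ (⊕<-dilate-double h ψ) (dilate-double ψ h)
... | odd h  rewrite ⌊1+n+n/2⌋≡n h =
  trans (cong₂ _xor_ (cong₂ _xor_ (⊕<-dilate-double h ψ) (dilate-double ψ h)) (dilate-odd ψ h))
        (xor-identityʳ _)

mulCoeff-comm : ∀ f g n → mulCoeff f g n ≡ mulCoeff g f n
mulCoeff-comm f g n = trans (⊕<-reverse (suc n) (λ k → f k ∧ g (n ∸ k))) (⊕<-cong (suc n) swap)
  where
  swap : ∀ i → i < suc n → f (n ∸ i) ∧ g (n ∸ (n ∸ i)) ≡ g i ∧ f (n ∸ i)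
  swap i i<1+n rewrite m∸[m∸n]≡n (≤-pred i<1+n) = ∧-comm (f (n ∸ i)) (g i)

mulCoeff-mulCoeff : ∀ f g h n →
  mulCoeff f (mulCoeff g h) n ≡
  ⊕< (suc n) (λ i → ⊕< (suc n) (λ j → (i + j ≤ᵇ n) ∧ ((f i ∧ g j) ∧ h (n ∸ (i + j)))))
mulCoeff-mulCoeff f g h n = ⊕<-cong (suc n) inner
  where
  term : ℕ → ℕ → Bool
  term i j = (i + j ≤ᵇ n) ∧ ((f i ∧ g j) ∧ h (n ∸ (i + j)))
  inner : ∀ i → i < suc n → f i ∧ mulCoeff g h (n ∸ i) ≡ ⊕< (suc n) (term i)
  inner i i<1+n = begin
    f i ∧ ⊕< (suc (n ∸ i)) (λ j → g j ∧ h (n ∸ i ∸ j))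
      ≡⟨ ⊕<-∧ˡ (suc (n ∸ i)) (f i) _ ⟩
    ⊕< (suc (n ∸ i)) (λ j → f i ∧ (g j ∧ h (n ∸ i ∸ j)))
      ≡⟨ ⊕<-cong (suc (n ∸ i)) in-range ⟩
    ⊕< (suc (n ∸ i)) (term i)
      ≡⟨ ⊕<-extend (term i) out-of-range (s≤s (m∸n≤m n i)) ⟩
    ⊕< (suc n) (term i)
      ∎
    where
    open ≡-Reasoning
    in-range : ∀ j → j < suc (n ∸ i) → f i ∧ (g j ∧ h (n ∸ i ∸ j)) ≡ term i j
    in-range j j<1+n∸i
      rewrite ≤ᵇ-true (≤-trans (+-monoʳ-≤ i (≤-pred j<1+n∸i)) (≤-reflexive (m+[n∸m]≡n (≤-pred i<1+n))))
            | ∸-+-assoc n i j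
            = sym (∧-assoc (f i) (g j) _)
    out-of-range : ∀ j → suc (n ∸ i) ≤ j → term i j ≡ false
    out-of-range j n∸i<j rewrite ≤ᵇ-false {i + j} {n} (≰⇒> (λ i+j≤n →
      <⇒≱ n∸i<j (m+n≤o⇒m≤o∸n j (subst (_≤ n) (+-comm i j) i+j≤n)))) = refl

mulCoeff-dilateˡ : ∀ f h n → mulCoeff (dilate f) h n ≡ ⊕< (suc ⌊ n /2⌋) (λ i → f i ∧ h (n ∸ (i + i)))
mulCoeff-dilateˡ f h n =
  trans (⊕<-cong (suc n) (λ y _ → dilate-∧ʳ f (λ y → h (n ∸ y)) y)) (⊕<-dilate n _)

-- Over F₂ the off-diagonal terms of F·(F·H) cancel in pairs, leaving F(q²)·H.
mulCoeff-square : ∀ f h n → mulCoeff f (mulCoeff f h) n ≡ mulCoeff (dilate f) h n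
mulCoeff-square f h n = begin
  mulCoeff f (mulCoeff f h) n                    ≡⟨ mulCoeff-mulCoeff f f h n ⟩
  ⊕< (suc n) (λ i → ⊕< (suc n) (term i))        ≡⟨ ⊕<-diagonal (suc n) term term-sym ⟩
  ⊕< (suc n) (λ i → term i i)                    ≡⟨ ⊕<-cong (suc n) (λ i _ → diagonal i) ⟩
  ⊕< (suc n) (λ i → (i + i ≤ᵇ n) ∧ ψ i)          ≡⟨ ⊕<-extend _ beyond-half (s≤s (⌊n/2⌋≤n n)) ⟨
  ⊕< (suc ⌊ n /2⌋) (λ i → (i + i ≤ᵇ n) ∧ ψ i)    ≡⟨ ⊕<-cong (suc ⌊ n /2⌋) up-to-half ⟩
  ⊕< (suc ⌊ n /2⌋) ψ                             ≡⟨ mulCoeff-dilateˡ f h n ⟨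
  mulCoeff (dilate f) h n                        ∎
  where
  open ≡-Reasoning
  term : ℕ → ℕ → Bool
  term i j = (i + j ≤ᵇ n) ∧ ((f i ∧ f j) ∧ h (n ∸ (i + j)))
  ψ : ℕ → Bool
  ψ i = f i ∧ h (n ∸ (i + i))
  term-sym : ∀ i j → term i j ≡ term j i
  term-sym i j rewrite +-comm i j | ∧-comm (f i) (f j) = refl
  diagonal : ∀ i → term i i ≡ (i + i ≤ᵇ n) ∧ ψ i
  diagonal i rewrite ∧-idem (f i) = refl
  beyond-half : ∀ i → suc ⌊ n /2⌋ ≤ i → (i + i ≤ᵇ n) ∧ ψ i ≡ false
  beyond-half i ⌊n/2⌋<i rewrite ≤ᵇ-false (⌊n/2⌋<m⇒n<m+m n ⌊n/2⌋<i) = refl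
  up-to-half : ∀ i → i < suc ⌊ n /2⌋ → (i + i ≤ᵇ n) ∧ ψ i ≡ ψ i
  up-to-half i i<1+⌊n/2⌋ rewrite ≤ᵇ-true (m≤⌊n/2⌋⇒m+m≤n n (≤-pred i<1+⌊n/2⌋)) = refl

mulCoeff-dilate : ∀ f g n → mulCoeff (dilate f) (dilate g) n ≡ dilate (mulCoeff f g) n
mulCoeff-dilate f g n = trans (mulCoeff-dilateˡ f (dilate g) n) (by-parity (evenOdd n))
  where
  by-parity : ∀ {n} → EvenOdd n →
    ⊕< (suc ⌊ n /2⌋) (λ i → f i ∧ dilate g (n ∸ (i + i))) ≡ dilate (mulCoeff f g) n
  by-parity (even h) rewrite sym (n≡⌊n+n/2⌋ h) | dilate-double (mulCoeff f g) h =
    ⊕<-cong (suc h) (λ i _ → cong (f i ∧_)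
      (trans (cong (dilate g) ([m+m]∸[n+n]≡[m∸n]+[m∸n] h i)) (dilate-double g (h ∸ i))))
  by-parity (odd h) rewrite ⌊1+n+n/2⌋≡n h | dilate-odd (mulCoeff f g) h =
    ⊕<-false (suc h) (λ i i<1+h → trans (cong (f i ∧_) (odd-term i (≤-pred i<1+h))) (∧-zeroʳ (f i)))
    where
    odd-term : ∀ i → i ≤ h → dilate g (suc (h + h) ∸ (i + i)) ≡ false
    odd-term i i≤h rewrite +-∸-assoc 1 (+-mono-≤ i≤h i≤h) | [m+m]∸[n+n]≡[m∸n]+[m∸n] h i =
      dilate-odd g (h ∸ i)

inverse-frobenius : ∀ {f g} → IsInverse f g → g ≗ mulCoeff f (dilate g)
inverse-frobenius {f} {g} inv = IsInverse-unique {f} inv λ n → begin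
  mulCoeff f (mulCoeff f (dilate g)) n   ≡⟨ mulCoeff-square f (dilate g) n ⟩
  mulCoeff (dilate f) (dilate g) n       ≡⟨ mulCoeff-dilate f g n ⟩
  dilate (mulCoeff f g) n                ≡⟨ dilate-cong n (λ h _ → inv h) ⟩
  dilate oneS n                          ≡⟨ dilate-oneS n ⟩
  oneS n                                 ∎
  where open ≡-Reasoning

-- Binary representations

weighted-∷ : ∀ {L} x (v : Vec ℕ L) → weighted (x ∷ v) ≡ x + (weighted v + weighted v)
weighted-∷ {L} x v = cong₂ _+_ (*-identityʳ x) (sum-double L (lookup v) (λ i → 2 ^ toℕ i))
  where
  sum-double : ∀ L (a e : Fin L → ℕ) →
    Vec.sum (tabulate (λ i → a i * (2 * e i))) ≡
    Vec.sum (tabulate (λ i → a i * e i)) + Vec.sum (tabulate (λ i → a i * e i))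
  sum-double zero    a e = refl
  sum-double (suc L) a e =
    trans (cong (a zero * (2 * e zero) +_) (sum-double L (λ i → a (suc i)) (λ i → e (suc i))))
          (distribute (a zero) (e zero) _)
    where
    distribute : ∀ a e s → a * (2 * e) + (s + s) ≡ (a * e + s) + (a * e + s)
    distribute = solve-∀

⊕L-double-≡ᵇ : ∀ {A : Set} (a : A → Bool) (w : A → ℕ) xs y →
  ⊕L (map (λ v → a v ∧ (w v + w v ≡ᵇ y)) xs) ≡
  dilate (λ h → ⊕L (map (λ v → a v ∧ (w v ≡ᵇ h)) xs)) y
⊕L-double-≡ᵇ a w xs y with evenOdd y
... | even h = trans (⊕L-cong xs (λ v → cong (a v ∧_) (m+m≡ᵇn+n (w v) h))) (sym (dilate-double _ h))
... | odd h  = trans (⊕L-false xs (λ v → trans (cong (a v ∧_) (m+m≡ᵇ1+n+n (w v) h)) (∧-zeroʳ (a v))))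
                     (sym (dilate-odd _ h))

binaryRepParity : Series → ℕ → ℕ → ℕ → Bool
binaryRepParity f B L n = ⊕L (map (λ v → allᵇ f v ∧ (weighted v ≡ᵇ n)) (allVecs B L))

binaryRepParity-suc : ∀ f B L n →
  binaryRepParity f B (suc L) n ≡
  ⊕< (suc B) (λ x → ((x ≤ᵇ n) ∧ f x) ∧ dilate (binaryRepParity f B L) (n ∸ x))
binaryRepParity-suc f B L n = trans (⊕L-allVecs-suc B L _) (⊕<-cong (suc B) (λ x _ → first-digit x))
  where
  first-digit : ∀ x → ⊕L (map (λ v → (f x ∧ allᵇ f v) ∧ (weighted (x ∷ v) ≡ᵇ n)) (allVecs B L))
                    ≡ ((x ≤ᵇ n) ∧ f x) ∧ dilate (binaryRepParity f B L) (n ∸ x)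
  first-digit x = begin
    ⊕L (map (λ v → (f x ∧ allᵇ f v) ∧ (weighted (x ∷ v) ≡ᵇ n)) (allVecs B L))
      ≡⟨ ⊕L-cong (allVecs B L) split-digit ⟩
    ⊕L (map (λ v → ((x ≤ᵇ n) ∧ f x) ∧ (allᵇ f v ∧ (weighted v + weighted v ≡ᵇ n ∸ x))) (allVecs B L))
      ≡⟨ ⊕L-∧ˡ ((x ≤ᵇ n) ∧ f x) _ (allVecs B L) ⟩
    ((x ≤ᵇ n) ∧ f x) ∧ ⊕L (map (λ v → allᵇ f v ∧ (weighted v + weighted v ≡ᵇ n ∸ x)) (allVecs B L))
      ≡⟨ cong (((x ≤ᵇ n) ∧ f x) ∧_) (⊕L-double-≡ᵇ (allᵇ f) weighted (allVecs B L) (n ∸ x)) ⟩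
    ((x ≤ᵇ n) ∧ f x) ∧ dilate (binaryRepParity f B L) (n ∸ x)
      ∎
    where
    open ≡-Reasoning
    split-digit : ∀ v → (f x ∧ allᵇ f v) ∧ (weighted (x ∷ v) ≡ᵇ n)
                      ≡ ((x ≤ᵇ n) ∧ f x) ∧ (allᵇ f v ∧ (weighted v + weighted v ≡ᵇ n ∸ x))
    split-digit v rewrite weighted-∷ x v | +-≡ᵇ x (weighted v + weighted v) n =
      ∧-rearrange (f x) (allᵇ f v) (x ≤ᵇ n) (weighted v + weighted v ≡ᵇ n ∸ x)
      where
      ∧-rearrange : ∀ f a c e → (f ∧ a) ∧ (c ∧ e) ≡ (c ∧ f) ∧ (a ∧ e)
      ∧-rearrange = solve 4 (λ f a c e → (f ⊕ a) ⊕ (c ⊕ e) ⊜ (c ⊕ f) ⊕ (a ⊕ e)) refl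

binaryRepParity-inverse : ∀ {f g} → IsInverse f g → ∀ B L n → n ≤ B → n < 2 ^ L →
                          binaryRepParity f B L n ≡ g n
binaryRepParity-inverse {f} {g} inv B zero    zero    _   _           =
  sym (proj₂ (IsInverse⇒constants {f} {g} inv))
binaryRepParity-inverse         inv B zero    (suc n) _   (s≤s ())
binaryRepParity-inverse {f} {g} inv B (suc L) n       n≤B n<2^[1+L] = begin
  binaryRepParity f B (suc L) n                 ≡⟨ binaryRepParity-suc f B L n ⟩
  ⊕< (suc B) term                               ≡⟨ ⊕<-extend term beyond-n (s≤s n≤B) ⟨
  ⊕< (suc n) term                               ≡⟨ ⊕<-cong (suc n) first-digit ⟩
  ⊕< (suc n) (λ x → f x ∧ dilate g (n ∸ x))     ≡⟨ inverse-frobenius {f} {g} inv n ⟨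
  g n                                           ∎
  where
  open ≡-Reasoning
  term : ℕ → Bool
  term x = ((x ≤ᵇ n) ∧ f x) ∧ dilate (binaryRepParity f B L) (n ∸ x)
  beyond-n : ∀ x → suc n ≤ x → term x ≡ false
  beyond-n x n<x rewrite ≤ᵇ-false n<x = refl
  other-digits : ∀ x h → h + h ≤ n ∸ x → binaryRepParity f B L h ≡ g h
  other-digits x h h+h≤n∸x = binaryRepParity-inverse {f} {g} inv B L h
    (≤-trans (m≤m+n h h) (≤-trans h+h≤n n≤B))
    (m+m<n+n⇒m<n (≤-<-trans h+h≤n (subst (n <_) (cong (2 ^ L +_) (+-identityʳ (2 ^ L))) n<2^[1+L])))
    where
    h+h≤n : h + h ≤ n
    h+h≤n = ≤-trans h+h≤n∸x (m∸n≤m n x)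
  first-digit : ∀ x → x < suc n → term x ≡ f x ∧ dilate g (n ∸ x)
  first-digit x x<1+n rewrite ≤ᵇ-true (≤-pred x<1+n) = cong (f x ∧_) (dilate-cong (n ∸ x) (other-digits x))

repCount-parity : ∀ {f g} → IsInverse f g → ∀ L n → n < 2 ^ L → g n ≡ true ⇔ repCount f n L % 2 ≡ 1
repCount-parity {f} {g} inv L n n<2^L =
  subst (λ b → b ≡ true ⇔ repCount f n L % 2 ≡ 1)
        (trans (isOdd-length-filterᵇ _ (allVecs n L)) (binaryRepParity-inverse {f} {g} inv n L n ≤-refl n<2^L))
        (isOdd⇔%2≡1 (repCount f n L))

-- Compositions

compositionSumOfLength : Series → ℕ → ℕ → Bool
compositionSumOfLength f zero    m = oneS m
compositionSumOfLength f (suc ℓ) m = ⊕< m (λ k → f (suc k) ∧ compositionSumOfLength f ℓ (m ∸ suc k))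

compositionSumOfLength-vanish : ∀ f ℓ m → m < ℓ → compositionSumOfLength f ℓ m ≡ false
compositionSumOfLength-vanish f (suc ℓ) m (s≤s m≤ℓ) = ⊕<-false m (λ k k<m →
  trans (cong (f (suc k) ∧_)
              (compositionSumOfLength-vanish f ℓ (m ∸ suc k) (<-≤-trans (∸-monoʳ-< z<s k<m) m≤ℓ)))
        (∧-zeroʳ (f (suc k))))

compositionTotal : Series → Series
compositionTotal f m = ⊕< (suc m) (λ ℓ → compositionSumOfLength f ℓ m)

compositionTotal-recurrence : ∀ f → InverseRecurrence f (compositionTotal f)
compositionTotal-recurrence f = record { constant = refl ; recurrence = step }
  where
  open ≡-Reasoning
  C : ℕ → ℕ → Bool
  C = compositionSumOfLength f
  step : ∀ m → compositionTotal f (suc m) ≡ ⊕< (suc m) (λ k → f (suc k) ∧ compositionTotal f (m ∸ k))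
  step m = begin
    ⊕< (suc (suc m)) (λ ℓ → C ℓ (suc m))
      ≡⟨ ⊕<-sucˡ (suc m) (λ ℓ → C ℓ (suc m)) ⟩
    ⊕< (suc m) (λ ℓ → ⊕< (suc m) (λ k → f (suc k) ∧ C ℓ (m ∸ k)))
      ≡⟨ ⊕<-swap (suc m) (suc m) (λ ℓ k → f (suc k) ∧ C ℓ (m ∸ k)) ⟩
    ⊕< (suc m) (λ k → ⊕< (suc m) (λ ℓ → f (suc k) ∧ C ℓ (m ∸ k)))
      ≡⟨ ⊕<-cong (suc m) (λ k _ → sym (⊕<-∧ˡ (suc m) (f (suc k)) (λ ℓ → C ℓ (m ∸ k)))) ⟩
    ⊕< (suc m) (λ k → f (suc k) ∧ ⊕< (suc m) (λ ℓ → C ℓ (m ∸ k)))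
      ≡⟨ ⊕<-cong (suc m) (λ k _ → cong (f (suc k) ∧_)
           (⊕<-extend (λ ℓ → C ℓ (m ∸ k)) (λ ℓ → compositionSumOfLength-vanish f ℓ (m ∸ k))
                      (s≤s (m∸n≤m m k)))) ⟨
    ⊕< (suc m) (λ k → f (suc k) ∧ compositionTotal f (m ∸ k))
      ∎

compositionListSum : Series → ℕ → ℕ → ℕ → Bool
compositionListSum f B ℓ m =
  ⊕L (map (λ v → (allᵇ (λ x → 0 <ᵇ x) v ∧ (Vec.sum v ≡ᵇ m)) ∧ allᵇ f v) (allVecs B ℓ))

compositionListSum-suc : ∀ f B ℓ m →
  compositionListSum f B (suc ℓ) m ≡
  ⊕< B (λ k → ((suc k ≤ᵇ m) ∧ f (suc k)) ∧ compositionListSum f B ℓ (m ∸ suc k))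
compositionListSum-suc f B ℓ m = begin
  ⊕L (map (q m) (allVecs B (suc ℓ)))
    ≡⟨ ⊕L-allVecs-suc B ℓ (q m) ⟩
  ⊕< (suc B) (λ x → ⊕L (map (λ v → q m (x ∷ v)) (allVecs B ℓ)))
    ≡⟨ ⊕<-sucˡ B _ ⟩
  ⊕L (map (λ v → q m (0 ∷ v)) (allVecs B ℓ))
    xor ⊕< B (λ k → ⊕L (map (λ v → q m (suc k ∷ v)) (allVecs B ℓ)))
    ≡⟨ cong (_xor ⊕< B (λ k → ⊕L (map (λ v → q m (suc k ∷ v)) (allVecs B ℓ))))
            (⊕L-false (allVecs B ℓ) (λ _ → refl)) ⟩
  ⊕< B (λ k → ⊕L (map (λ v → q m (suc k ∷ v)) (allVecs B ℓ)))
    ≡⟨ ⊕<-cong B (λ k _ → first-part k) ⟩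
  ⊕< B (λ k → ((suc k ≤ᵇ m) ∧ f (suc k)) ∧ compositionListSum f B ℓ (m ∸ suc k))
    ∎
  where
  open ≡-Reasoning
  q : ℕ → ∀ {L} → Vec ℕ L → Bool
  q m v = (allᵇ (λ x → 0 <ᵇ x) v ∧ (Vec.sum v ≡ᵇ m)) ∧ allᵇ f v
  first-part : ∀ k → ⊕L (map (λ v → q m (suc k ∷ v)) (allVecs B ℓ))
                   ≡ ((suc k ≤ᵇ m) ∧ f (suc k)) ∧ compositionListSum f B ℓ (m ∸ suc k)
  first-part k = trans (⊕L-cong (allVecs B ℓ) split-part)
                       (⊕L-∧ˡ ((suc k ≤ᵇ m) ∧ f (suc k)) (q (m ∸ suc k)) (allVecs B ℓ))
    where
    split-part : ∀ v → q m (suc k ∷ v) ≡ ((suc k ≤ᵇ m) ∧ f (suc k)) ∧ q (m ∸ suc k) v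
    split-part v rewrite +-≡ᵇ (suc k) (Vec.sum v) m =
      ∧-rearrange (allᵇ (λ x → 0 <ᵇ x) v) (suc k ≤ᵇ m) (Vec.sum v ≡ᵇ m ∸ suc k) (f (suc k)) (allᵇ f v)
      where
      ∧-rearrange : ∀ a c e f b → (a ∧ (c ∧ e)) ∧ (f ∧ b) ≡ (c ∧ f) ∧ ((a ∧ e) ∧ b)
      ∧-rearrange = solve 5 (λ a c e f b → (a ⊕ (c ⊕ e)) ⊕ (f ⊕ b) ⊜ (c ⊕ f) ⊕ ((a ⊕ e) ⊕ b)) refl

compositionListSum≡compositionSumOfLength : ∀ f B ℓ m → m ≤ B →
  compositionListSum f B ℓ m ≡ compositionSumOfLength f ℓ m
compositionListSum≡compositionSumOfLength f B zero    zero    _   = refl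
compositionListSum≡compositionSumOfLength f B zero    (suc m) _   = refl
compositionListSum≡compositionSumOfLength f B (suc ℓ) m       m≤B = begin
  compositionListSum f B (suc ℓ) m  ≡⟨ compositionListSum-suc f B ℓ m ⟩
  ⊕< B term                         ≡⟨ ⊕<-extend term beyond-m m≤B ⟨
  ⊕< m term                         ≡⟨ ⊕<-cong m below-m ⟩
  compositionSumOfLength f (suc ℓ) m ∎
  where
  open ≡-Reasoning
  term : ℕ → Bool
  term k = ((suc k ≤ᵇ m) ∧ f (suc k)) ∧ compositionListSum f B ℓ (m ∸ suc k)
  beyond-m : ∀ k → m ≤ k → term k ≡ false
  beyond-m k m≤k rewrite ≤ᵇ-false {suc k} {m} (s≤s m≤k) = refl
  below-m : ∀ k → k < m → term k ≡ f (suc k) ∧ compositionSumOfLength f ℓ (m ∸ suc k)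
  below-m k k<m rewrite ≤ᵇ-true k<m =
    cong (f (suc k) ∧_)
         (compositionListSum≡compositionSumOfLength f B ℓ (m ∸ suc k) (≤-trans (m∸n≤m m (suc k)) m≤B))

inverse-compositionSum : ∀ {f g} → IsInverse f g → ∀ m → g (suc m) ≡ compositionSum f (suc m)
inverse-compositionSum {f} {g} inv m = begin
  g (suc m)
    ≡⟨ IsInverse⇒≗inverse {f} {g} inv (suc m) ⟩
  inverse f (suc m)
    ≡⟨ InverseRecurrence⇒≗inverse (compositionTotal-recurrence f) (suc m) ⟨
  compositionTotal f (suc m)
    ≡⟨ ⊕<-sucˡ (suc m) (λ ℓ → compositionSumOfLength f ℓ (suc m)) ⟩
  ⊕< (suc m) (λ k → compositionSumOfLength f (suc k) (suc m))
    ≡⟨ ⊕<-cong (suc m) (λ k _ → list-form k) ⟨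
  compositionSum f (suc m)
    ∎
  where
  open ≡-Reasoning
  list-form : ∀ k → ⊕L (map (allᵇ f) (filterᵇ (λ v → allᵇ (λ x → 0 <ᵇ x) v ∧ (Vec.sum v ≡ᵇ suc m))
                                               (allVecs (suc m) (suc k))))
                  ≡ compositionSumOfLength f (suc k) (suc m)
  list-form k = trans (⊕L-filterᵇ _ (allᵇ f) (allVecs (suc m) (suc k)))
                      (compositionListSum≡compositionSumOfLength f (suc m) (suc k) (suc m) ≤-refl)

-- The lacunary recurrence

prefixSeries : ∀ {m} → Vec Bool m → Series
prefixSeries v       zero          = true
prefixSeries []      (suc k)       = false
prefixSeries (b ∷ v) (suc zero)    = b
prefixSeries (b ∷ v) (suc (suc k)) = prefixSeries v (suc k)

prefixSeries-tabulate : ∀ m (φ : ℕ → Bool) k → k < m →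
                        prefixSeries (tabulate {n = m} (λ i → φ (toℕ i))) (suc k) ≡ φ k
prefixSeries-tabulate (suc m) φ zero    _         = refl
prefixSeries-tabulate (suc m) φ (suc k) (s≤s k<m) = prefixSeries-tabulate m (λ j → φ (suc j)) k k<m

prefixSeries-agree : ∀ {f : Series} m → f 0 ≡ true → ∀ x → x ≤ m →
                     prefixSeries (tabulate {n = m} (λ k → f (suc (toℕ k)))) x ≡ f x
prefixSeries-agree     m f0 zero    _   = sym f0
prefixSeries-agree {f} m f0 (suc k) k<m = prefixSeries-tabulate m (λ j → f (suc j)) k k<m

-- The paper's G_n: the terms with 4i ≥ n, which only involve f₁,…,f_{⌊n/2⌋}.
upperTerms : (n : ℕ) → Vec Bool (n / 2) → Bool
upperTerms n v =
  ⊕< (suc ⌊ n /2⌋) (λ i → not (4 * i <ᵇ n) ∧ (inverse (prefixSeries v) i ∧ prefixSeries v (n ∸ (i + i))))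

lowerTerms : ∀ (f g : Series) n → 0 < n →
  ⊕< (suc ⌊ n /2⌋) (λ i → (4 * i <ᵇ n) ∧ (g i ∧ f (n ∸ (i + i)))) ≡
  ⊕< n (λ i → if 4 * i <ᵇ n then f (n ∸ 2 * i) ∧ g i else false)
lowerTerms f g n@(suc n-1) _ =
  trans (⊕<-extend _ beyond-half (⌊n/2⌋<n n-1)) (⊕<-cong n (λ i _ → reorder i))
  where
  n≤4i : ∀ i → ⌊ n /2⌋ < i → n ≤ 4 * i
  n≤4i i ⌊n/2⌋<i = ≤-trans (<⇒≤ (⌊n/2⌋<m⇒n<m+m n ⌊n/2⌋<i))
                           (≤-trans (m≤m+n (i + i) (i + i)) (≤-reflexive (sym (4*m≡[m+m]+[m+m] i))))
  beyond-half : ∀ i → suc ⌊ n /2⌋ ≤ i → (4 * i <ᵇ n) ∧ (g i ∧ f (n ∸ (i + i))) ≡ false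
  beyond-half i ⌊n/2⌋<i rewrite det (<ᵇ-reflects-< (4 * i) n) (ofⁿ (≤⇒≯ (n≤4i i ⌊n/2⌋<i))) = refl
  reorder : ∀ i → (4 * i <ᵇ n) ∧ (g i ∧ f (n ∸ (i + i))) ≡
                  (if 4 * i <ᵇ n then f (n ∸ 2 * i) ∧ g i else false)
  reorder i with 4 * i <ᵇ n
  ... | true  = trans (∧-comm (g i) _) (cong (λ j → f (n ∸ j) ∧ g i) (cong (i +_) (sym (+-identityʳ i))))
  ... | false = refl

upperTerms-prefix : ∀ {f g} → IsInverse f g → ∀ n →
  ⊕< (suc ⌊ n /2⌋) (λ i → not (4 * i <ᵇ n) ∧ (g i ∧ f (n ∸ (i + i)))) ≡
  upperTerms n (tabulate (λ (k : Fin (n / 2)) → f (suc (toℕ k))))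
upperTerms-prefix {f} {g} inv n =
  ⊕<-cong (suc ⌊ n /2⌋) (λ i i<1+⌊n/2⌋ → from-prefix i (≤-pred i<1+⌊n/2⌋))
  where
  f′ : Series
  f′ = prefixSeries (tabulate (λ (k : Fin (n / 2)) → f (suc (toℕ k))))
  agree : ∀ x → x ≤ ⌊ n /2⌋ → f x ≡ f′ x
  agree x x≤⌊n/2⌋ =
    sym (prefixSeries-agree {f} (n / 2) (proj₁ (IsInverse⇒constants {f} {g} inv)) x
                            (subst (x ≤_) (⌊n/2⌋≡n/2 n) x≤⌊n/2⌋))
  from-prefix : ∀ i → i ≤ ⌊ n /2⌋ →
    not (4 * i <ᵇ n) ∧ (g i ∧ f (n ∸ (i + i))) ≡
    not (4 * i <ᵇ n) ∧ (inverse f′ i ∧ f′ (n ∸ (i + i)))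
  from-prefix i i≤⌊n/2⌋ with 4 * i <ᵇ n | <ᵇ-reflects-< (4 * i) n
  ... | true  | _        = refl
  ... | false | ofⁿ 4i≮n = cong₂ _∧_
    (trans (IsInverse⇒≗inverse {f} {g} inv i)
           (inverse-local i (λ k k<i → agree (suc k) (≤-trans k<i i≤⌊n/2⌋))))
    (agree (n ∸ (i + i)) (n∸[m+m]≤⌊n/2⌋ n i (≮⇒≥ 4i≮n)))

inverse-lacunary : ∀ {f g} → IsInverse f g → ∀ n → 0 < n →
  g n ≡ ⊕< n (λ i → if 4 * i <ᵇ n then f (n ∸ 2 * i) ∧ g i else false)
        xor upperTerms n (tabulate (λ (k : Fin (n / 2)) → f (suc (toℕ k))))
inverse-lacunary {f} {g} inv n 0<n = begin
  g n                                       ≡⟨ inverse-frobenius {f} {g} inv n ⟩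
  mulCoeff f (dilate g) n                   ≡⟨ mulCoeff-comm f (dilate g) n ⟩
  mulCoeff (dilate g) f n                   ≡⟨ mulCoeff-dilateˡ g f n ⟩
  ⊕< (suc ⌊ n /2⌋) ψ                        ≡⟨ ⊕<-split (suc ⌊ n /2⌋) (λ i → 4 * i <ᵇ n) ψ ⟩
  ⊕< (suc ⌊ n /2⌋) (λ i → (4 * i <ᵇ n) ∧ ψ i) xor ⊕< (suc ⌊ n /2⌋) (λ i → not (4 * i <ᵇ n) ∧ ψ i)
                                            ≡⟨ cong₂ _xor_ (lowerTerms f g n 0<n) (upperTerms-prefix {f} {g} inv n) ⟩
  ⊕< n (λ i → if 4 * i <ᵇ n then f (n ∸ 2 * i) ∧ g i else false)
    xor upperTerms n (tabulate (λ (k : Fin (n / 2)) → f (suc (toℕ k))))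
                                            ∎
  where
  open ≡-Reasoning
  ψ : ℕ → Bool
  ψ i = g i ∧ f (n ∸ (i + i))

lemma2p2 :
    ((f fb : Series) → IsInverse f fb →
      fb 0 ≡ true
      × ((n : ℕ) → 0 < n →
          (fb n ≡ ⊕< n (λ k → f (suc k) ∧ fb (n ∸ suc k)))
          × ((L : ℕ) → n < 2 ^ L → (fb n ≡ true ⇔ repCount f n L % 2 ≡ 1))
          × (fb n ≡ compositionSum f n)))
    × ((n : ℕ) → 0 < n →
        Σ[ G ∈ (Vec Bool (n / 2) → Bool) ]
          ((f fb : Series) → IsInverse f fb →
            fb n ≡ (⊕< n (λ i → if (4 * i) <ᵇ n then f (n ∸ 2 * i) ∧ fb i else false)
                    xor G (tabulate (λ (k : Fin (n / 2)) → f (suc (toℕ k)))))))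
lemma2p2 =
    (λ f fb inv → proj₂ (IsInverse⇒constants {f} {fb} inv) , λ where
      (suc m) _ → InverseRecurrence.recurrence (IsInverse⇒InverseRecurrence {f} {fb} inv) m
                , (λ L → repCount-parity {f} {fb} inv L (suc m))
                , inverse-compositionSum {f} {fb} inv m)
  , (λ n 0<n → upperTerms n , λ f fb inv → inverse-lacunary {f} {fb} inv n 0<n)
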